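{- Let $d\ge 3$, let $G$ be a $d$-degenerate chordal graph with perfect elimination ordering $v_1,\dots,v_n$, let $\alpha,\beta$ be proper $(2d+1)$-colorings of $G$, and let $\mathcal{S}$ be a best choice recoloring sequence for $G$ and this ordering from $\alpha$ to $\beta$. Let $v$ be any vertex of $G$ and let $w_1,\dots,w_\ell \in N^-(v)$ (repetitions allowed) with $\ell \le d-1$. Then the pattern $vv$ never occurs in $\mathcal{S}_{|N^-[v]}$, and the pattern $v w_1 \dots w_\ell v$ occurs at most once in $\mathcal{S}_{|N^-[v]}$, and if it occurs then its second recoloring of $v$ is the last recoloring of $v$ in $\mathcal{S}_{|N^-[v]}$.
   Context: A proper $t$-coloring of $G$ is a map $V(G)\to[t]=\{1,\dots,t\}$ giving adjacent vertices distinct colors. A perfect elimination ordering $v_1,\dots,v_n$ of a chordal graph is one in which, writing $N^-(v_i)=N(v_i)\cap\{v_1,\dots,v_{i-1}\}$, each $N^-(v_i)$ is a clique; for $d$-degenerate chordal $G$ one has $|N^-(v_i)|\le d$. Write $N^-[v]=N^-(v)\cup\{v\}$, $G_i=G[\{v_1,\dots,v_i\}]$. Recoloring sequences: from a coloring $\alpha_0$, a recoloring sequence is $s_1\dots s_m$ with $s_i=(x_i,c_i)$; $\alpha_i$ is obtained from $\alpha_{i-1}$ by giving $x_i$ color $c_i$, and all $\alpha_i$ must be proper; it goes from $\alpha_0$ to $\alpha_m$. For $X\subseteq V(G)$, $\mathcal{S}_{|X}$ is the subsequence of pairs whose vertex lies in $X$. A pattern (sequence of vertices) $y_0y_1\dots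 y_p$ occurs in a recoloring sequence at index $i$ if for all $0\le j\le p$ the $(i+j)$-th element recolors $y_j$; the number of occurrences is the number of such indices. Best choice recoloring sequence: built inductively; $\mathcal{S}_i$ is a recoloring sequence of $G_i$ from $\alpha_{|G_i}$ to $\beta_{|G_i}$ ($\mathcal{S}_0$ empty), and $\mathcal{S}=\mathcal{S}_n$. To get $\mathcal{S}_i$ from $\mathcal{S}_{i-1}$ (Local Best Choice for $u=v_i$): let $t_1<\dots<t_\ell$ be the steps of $\mathcal{S}_{i-1}$ recoloring a vertex of $N^-(u)$, with new colors $c_{t_1},\dots,c_{t_\ell}$. Starting with $u$ colored $\alpha(u)$, whenever step $t_j$ gives its vertex the current color of $u$, a recoloring of $u$ to its best choice at step $t_j$ is inserted immediately before that step (this recoloring of $u$ is said to be caused by the vertex recolored at $t_j$); no other recolorings of $u$ are made, except that at the very end $u$ is recolored to $\beta(u)$ if needed. A color is valid for $u$ at step $t$ if it differs from the current colors (just before step $t$) of $u$ and of all vertices of $N^-(u)$. The best choice for $u$ at step $t\in\{t_1,\dots,t_\ell\}$ is: $\beta(u)$ if it is valid and distinct from all $c_{t_j}$ with $t_j\ge t$; otherwise any valid color distinct from all $c_{t_j}$ with $t_j\ge t$; otherwise the valid color whose first appearance in the sequence $(c_{t_j})_{t_j\ge t}$ is latest. -}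

module Defs where

open import Data.Nat using (ℕ; zero; suc; _≤_)
open import Data.Fin as F using (Fin; toℕ; _<_; _<?_; _≟_)
open import Data.Fin.Subset as Sub using (Subset; Nonempty; ∣_∣; _∩_)
open import Data.Vec using (tabulate)
open import Data.List using (List; []; _∷_; map; take; drop; length)
open import Data.List.Membership.Propositional as LM using (_∉_)
open import Data.Product using (_×_; _,_; ∃; proj₁)
open import Data.Sum using (_⊎_)
open import Data.Bool using (if_then_else_)
open import Relation.Nullary using (¬_; Dec; does)
open import Relation.Nullary.Decidable using (_×-dec_; _⊎-dec_)
open import Relation.Binary.PropositionalEquality using (_≡_; _≢_)

-- A finite simple (undirected, loopless) graph on the vertex set Fin n.
-- The perfect elimination ordering v₁,…,vₙ is the natural order of Fin n
-- (v_{i+1} is the vertex with index i).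
record Graph (n : ℕ) : Set₁ where
  field
    Adj    : Fin n → Fin n → Set
    adj?   : ∀ x y → Dec (Adj x y)
    sym    : ∀ {x y} → Adj x y → Adj y x
    irrefl : ∀ {x} → ¬ Adj x x

-- A recoloring step (x , c): give vertex x the colour c.
Step : ℕ → ℕ → Set
Step n t = Fin n × Fin t

-- first position of c in a list (the length of the list if absent)
firstIdx : ∀ {t} → Fin t → List (Fin t) → ℕ
firstIdx c [] = zero
firstIdx c (x ∷ xs) = if does (c ≟ x) then zero else suc (firstIdx c xs)

OccursAt : ∀ {n t} → List (Fin n) → List (Step n t) → ℕ → Set
OccursAt ys S i = take (length ys) (drop i (map proj₁ S)) ≡ ys

module _ {n : ℕ} (G : Graph n) where
  open Graph G

  Pred : Fin n → Fin n → Set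
  Pred w u = (w < u) × Adj w u

  pred? : ∀ w u → Dec (Pred w u)
  pred? w u = (w <? u) ×-dec adj? w u

  ClosedPred : Fin n → Fin n → Set
  ClosedPred w u = (w ≡ u) ⊎ Pred w u

  closed? : ∀ w u → Dec (ClosedPred w u)
  closed? w u = (w ≟ u) ⊎-dec pred? w u

  IsPEO : Set
  IsPEO = ∀ u w w' → Pred w u → Pred w' u → w ≢ w' → Adj w w'

  nbhd : Fin n → Subset n
  nbhd v = tabulate (λ w → does (adj? v w))

  Degenerate : ℕ → Set
  Degenerate d = ∀ (S : Subset n) → Nonempty S →
                 ∃ λ v → v Sub.∈ S × ∣ nbhd v ∩ S ∣ ≤ d

  Proper : ∀ {t} → (Fin n → Fin t) → Set
  Proper c = ∀ x y → Adj x y → c x ≢ c y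

  restrict : ∀ {t} → Fin n → List (Step n t) → List (Step n t)
  restrict v [] = []
  restrict v ((x , c) ∷ r) =
    if does (closed? x v) then (x , c) ∷ restrict v r else restrict v r

  module _ {t : ℕ} where

    update : (Fin n → Fin t) → Fin n → Fin t → (Fin n → Fin t)
    update col x k y = if does (y ≟ x) then k else col y

    futureColors : Fin n → List (Step n t) → List (Fin t)
    futureColors u [] = []
    futureColors u ((x , c) ∷ r) =
      if does (pred? x u) then c ∷ futureColors u r else futureColors u r

    Valid : Fin n → (Fin n → Fin t) → Fin t → Fin t → Set
    Valid u cur cu b = (b ≢ cu) × (∀ w → Pred w u → b ≢ cur w)

    data BestChoice (β : Fin n → Fin t) (u : Fin n) (cur : Fin n → Fin t)
                    (cu : Fin t) (Fs : List (Fin t)) : Fin t → Set where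
      bc₁ : Valid u cur cu (β u) → β u ∉ Fs → BestChoice β u cur cu Fs (β u)
      bc₂ : ∀ {c} → ¬ (Valid u cur cu (β u) × β u ∉ Fs) →
            Valid u cur cu c → c ∉ Fs → BestChoice β u cur cu Fs c
      bc₃ : ∀ {b} → (∀ c → Valid u cur cu c → c LM.∈ Fs) →
            Valid u cur cu b →
            (∀ c → Valid u cur cu c → firstIdx c Fs ≤ firstIdx b Fs) →
            BestChoice β u cur cu Fs b

    -- Local Best Choice for u: Insert β u cur cu S S' means that S' is obtained
    -- by inserting recolorings of u into the (remaining) sequence S, where
    -- cur is the current colouring of the other vertices and cu that of u.
    data Insert (β : Fin n → Fin t) (u : Fin n) :
                (Fin n → Fin t) → Fin t → List (Step n t) → List (Step n t) → Set where
      ins-end   : ∀ {cur cu} → cu ≡ β u → Insert β u cur cu [] []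
      ins-fix   : ∀ {cur cu} → cu ≢ β u → Insert β u cur cu [] ((u , β u) ∷ [])
      ins-other : ∀ {cur cu x c r r'} → ¬ Pred x u →
                  Insert β u (update cur x c) cu r r' →
                  Insert β u cur cu ((x , c) ∷ r) ((x , c) ∷ r')
      ins-free  : ∀ {cur cu x c r r'} → Pred x u → c ≢ cu →
                  Insert β u (update cur x c) cu r r' →
                  Insert β u cur cu ((x , c) ∷ r) ((x , c) ∷ r')
      ins-clash : ∀ {cur cu x c r r' b} → Pred x u → c ≡ cu →
                  BestChoice β u cur cu (futureColors u ((x , c) ∷ r)) b →
                  Insert β u (update cur x c) b r r' →
                  Insert β u cur cu ((x , c) ∷ r) ((u , b) ∷ (x , c) ∷ r')

    -- BCSeq α β i S : S is the best choice sequence S_i for G_i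
    data BCSeq (α β : Fin n → Fin t) : ℕ → List (Step n t) → Set where
      bcs-nil  : BCSeq α β zero []
      bcs-step : ∀ {S S'} (u : Fin n) → BCSeq α β (toℕ u) S →
                 Insert β u α (α u) S S' → BCSeq α β (suc (toℕ u)) S'

    BestChoiceSeq : (α β : Fin n → Fin t) → List (Step n t) → Set
    BestChoiceSeq α β S = BCSeq α β n S

{-# OPTIONS --safe #-}
-- Recolourings of v are inserted only while v itself is processed, each immediately
-- before the recolouring of a vertex of N⁻(v) that takes v's current colour; vertices processed
-- later lie outside N⁻[v], so they leave the restriction to N⁻[v] unchanged. A colour given to v
-- is not taken by a neighbour before at least d recolourings of N⁻(v) have passed: under the
-- first two rules it never reappears among the later colours of N⁻(v), and under the third, if it
-- reappeared among the next d of them, then these d colours (the first being v's old colour)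
-- together with the at most d current colours on the clique N⁻(v) would cover all 2d+1 colours.
-- Hence consecutive recolourings of v in the restriction are separated by at least one step, and
-- by at least d steps unless the second is the last recolouring of v.

module Submission where

open import Defs
open import Data.Nat using (ℕ; zero; suc; _+_; _*_; _∸_; _≤_; _<_; z≤n; s≤s; _≤?_)
open import Data.Nat.Properties
  using (≤-trans; ≤-reflexive; ≤-antisym; ≤-pred; ≤-<-trans; <⇒≱; ≰⇒>; n≤1+n; n<1+n; m<n⇒m<1+n;
         m≤n⇒m<n∨m≡n; m≤m+n; m⊓n≤m; +-suc; +-comm; +-identityʳ; +-mono-≤; +-monoʳ-≤; +-cancelʳ-≡)
open import Data.Fin as F using (Fin; toℕ)
import Data.Fin.Properties as FP
open import Data.Fin.Subset using (Subset; ∣_∣; _∩_; _∪_; ⁅_⁆; _⊆_; _⊂_; inside; outside) renaming (_∈_ to _∈ₛ_)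
import Data.Fin.Subset.Properties as SP
import Data.Vec as V
import Data.Vec.Properties as VP
open import Data.List using (List; []; _∷_; _++_; length; map; take; drop; filter; allFin; lookup)
import Data.List.Properties as LP
open import Data.List.Relation.Unary.All as All using (All; []; _∷_)
open import Data.List.Relation.Unary.Any using (here; there; index)
open import Data.List.Relation.Unary.Any.Properties using (lookup-index)
open import Data.List.Membership.Propositional using (_∈_; _∉_)
open import Data.List.Membership.Propositional.Properties using (∈-map⁺; ∈-filter⁺; ∈-allFin; ∈-++⁺ˡ; ∈-++⁺ʳ)
open import Data.Product using (_×_; _,_; proj₁; proj₂; ∃)
open import Data.Sum using (_⊎_; inj₁; inj₂)
open import Data.Bool using (true; false; if_then_else_)
open import Data.Empty using (⊥-elim)
open import Relation.Nullary using (¬_; Dec; yes; no; does; proof; Reflects; invert)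
open import Relation.Nullary.Decidable using (dec-true; dec-false)
open import Relation.Binary.PropositionalEquality using (_≡_; _≢_; refl; sym; trans; cong; subst)

module _ {A : Set} where

  -- OccursAt ys S i of Defs unfolds to Occurs ys (map proj₁ S) i.
  Occurs : List A → List A → ℕ → Set
  Occurs ys xs i = take (length ys) (drop i xs) ≡ ys

  Occurs⇒drop≡++ : ∀ {ys xs} i → Occurs ys xs i → ∃ λ rest → drop i xs ≡ ys ++ rest
  Occurs⇒drop≡++ {ys} {xs} i occ =
    drop (length ys) (drop i xs) ,
    trans (sym (LP.take++drop≡id (length ys) (drop i xs))) (cong (_++ drop (length ys) (drop i xs)) occ)

  drop-length-++ : ∀ (ws : List A) {ys} → drop (length ws) (ws ++ ys) ≡ ys
  drop-length-++ []       = refl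
  drop-length-++ (w ∷ ws) = drop-length-++ ws

  Occurs-∷ʳ : ∀ {u v : A} {ws xs} i → Occurs (u ∷ ws ++ v ∷ []) xs i →
              ∃ λ rest → drop i xs ≡ u ∷ ws ++ v ∷ rest × drop (i + suc (length ws)) xs ≡ v ∷ rest
  Occurs-∷ʳ {u} {v} {ws} {xs} i occ with Occurs⇒drop≡++ i occ
  ... | rest , at-i = rest , at-u , at-v
    where
      at-u : drop i xs ≡ u ∷ ws ++ v ∷ rest
      at-u = trans at-i (cong (u ∷_) (LP.++-assoc ws (v ∷ []) rest))
      at-v : drop (i + suc (length ws)) xs ≡ v ∷ rest
      at-v = trans (sym (LP.drop-drop i (suc (length ws)) xs))
                   (trans (cong (drop (suc (length ws))) at-u) (drop-length-++ ws))

  Occurs-head : ∀ {v : A} {xs rest} j → drop j xs ≡ v ∷ rest → Occurs (v ∷ []) xs j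
  Occurs-head j eq = cong (take 1) eq

  All≢⇒¬Occurs : ∀ {v : A} {xs} → All (_≢ v) xs → ∀ k → ¬ Occurs (v ∷ []) xs k
  All≢⇒¬Occurs {xs = []}     _            zero    ()
  All≢⇒¬Occurs {xs = []}     _            (suc k) ()
  All≢⇒¬Occurs {xs = x ∷ xs} (x≢v ∷ _)    zero    occ = x≢v (proj₁ (LP.∷-injective occ))
  All≢⇒¬Occurs {xs = x ∷ xs} (_ ∷ xs≢v)   (suc k) occ = All≢⇒¬Occurs xs≢v k occ

  Occurs-≤-last : ∀ {v : A} j {xs rest} → drop j xs ≡ v ∷ rest → All (_≢ v) rest →
                  ∀ k → Occurs (v ∷ []) xs k → k ≤ j
  Occurs-≤-last zero    {[]}     ()
  Occurs-≤-last (suc j) {[]}     ()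
  Occurs-≤-last zero    {x ∷ xs} refl rest≢v zero    _   = z≤n
  Occurs-≤-last zero    {x ∷ xs} refl rest≢v (suc k) occ = ⊥-elim (All≢⇒¬Occurs rest≢v k occ)
  Occurs-≤-last (suc j) {x ∷ xs} eq   rest≢v zero    _   = z≤n
  Occurs-≤-last (suc j) {x ∷ xs} eq   rest≢v (suc k) occ = s≤s (Occurs-≤-last j eq rest≢v k occ)

module Spacing {A : Set} (d : ℕ) (v : A) where

  -- m counts the entries since the previous v.
  data Spaced : ℕ → List A → Set where
    []    : ∀ {m} → Spaced m []
    other : ∀ {m x xs} → x ≢ v → Spaced (suc m) xs → Spaced m (x ∷ xs)
    visit : ∀ {m xs} → 1 ≤ m → d ≤ m ⊎ All (_≢ v) xs → Spaced 0 xs → Spaced m (v ∷ xs)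

  Spaced-drop : ∀ {m} i {xs} → Spaced m xs → ∃ λ m′ → Spaced m′ (drop i xs)
  Spaced-drop zero    s             = _ , s
  Spaced-drop (suc i) []            = zero , []
  Spaced-drop (suc i) (other _ s)   = Spaced-drop i s
  Spaced-drop (suc i) (visit _ _ s) = Spaced-drop i s

  Spaced-suffix : ∀ {m} i {xs ys} → drop i xs ≡ ys → Spaced m xs → ∃ λ m′ → Spaced m′ ys
  Spaced-suffix i refl s = Spaced-drop i s

  Spaced-++ : ∀ {m ys} ws → All (_≢ v) ws → Spaced m (ws ++ ys) → Spaced (length ws + m) ys
  Spaced-++          []       _          s             = s
  Spaced-++ {m} {ys} (w ∷ ws) (_ ∷ ws≢v) (other _ s)   =
    subst (λ k → Spaced k ys) (+-suc (length ws) m) (Spaced-++ ws ws≢v s)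
  Spaced-++          (w ∷ ws) (w≢v ∷ _)  (visit _ _ _) = ⊥-elim (w≢v refl)

  ¬Spaced-vv : ∀ {m xs} → ¬ Spaced m (v ∷ v ∷ xs)
  ¬Spaced-vv (other v≢v _)               = v≢v refl
  ¬Spaced-vv (visit _ _ (other v≢v _))   = v≢v refl
  ¬Spaced-vv (visit _ _ (visit () _ _))

  Spaced-v∷ws∷v : ∀ {m xs} ws → All (_≢ v) ws → length ws < d →
                  Spaced m (v ∷ ws ++ v ∷ xs) → All (_≢ v) xs
  Spaced-v∷ws∷v ws ws≢v |ws|<d (other v≢v _) = ⊥-elim (v≢v refl)
  Spaced-v∷ws∷v ws ws≢v |ws|<d (visit _ _ s) with Spaced-++ ws ws≢v s
  ... | other v≢v _             = ⊥-elim (v≢v refl)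
  ... | visit _ (inj₂ xs≢v) _   = xs≢v
  ... | visit _ (inj₁ d≤|ws|) _ = ⊥-elim (<⇒≱ |ws|<d (subst (d ≤_) (+-identityʳ (length ws)) d≤|ws|))

  module _ {m xs} (spaced : Spaced m xs) where

    Spaced⇒¬Occurs-vv : ∀ i → ¬ Occurs (v ∷ v ∷ []) xs i
    Spaced⇒¬Occurs-vv i occ with Occurs⇒drop≡++ i occ
    ... | _ , at-i = ¬Spaced-vv (proj₂ (Spaced-suffix i at-i spaced))

    module _ {ws} (ws≢v : All (_≢ v) ws) (|ws|<d : length ws < d) where

      Spaced⇒Occurs-last : ∀ i → Occurs (v ∷ ws ++ v ∷ []) xs i →
                           ∀ k → Occurs (v ∷ []) xs k → k ≤ i + suc (length ws)
      Spaced⇒Occurs-last i occ with Occurs-∷ʳ i occ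
      ... | _ , at-i , at-second =
        Occurs-≤-last (i + suc (length ws)) at-second
          (Spaced-v∷ws∷v ws ws≢v |ws|<d (proj₂ (Spaced-suffix i at-i spaced)))

      Spaced⇒Occurs-unique : ∀ i j → Occurs (v ∷ ws ++ v ∷ []) xs i →
                             Occurs (v ∷ ws ++ v ∷ []) xs j → i ≡ j
      Spaced⇒Occurs-unique i j occ-i occ-j =
        +-cancelʳ-≡ (suc (length ws)) i j
          (≤-antisym (Spaced⇒Occurs-last j occ-j _ (second i occ-i))
                     (Spaced⇒Occurs-last i occ-i _ (second j occ-j)))
        where
          second : ∀ k → Occurs (v ∷ ws ++ v ∷ []) xs k → Occurs (v ∷ []) xs (k + suc (length ws))
          second k occ = Occurs-head {xs = xs} (k + suc (length ws)) (proj₂ (proj₂ (Occurs-∷ʳ k occ)))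

∣p∪q∣≤∣p∣+∣q∣ : ∀ {m} (p q : Subset m) → ∣ p ∪ q ∣ ≤ ∣ p ∣ + ∣ q ∣
∣p∪q∣≤∣p∣+∣q∣ V.[]            V.[]            = z≤n
∣p∪q∣≤∣p∣+∣q∣ (inside  V.∷ p) (inside  V.∷ q) =
  s≤s (≤-trans (∣p∪q∣≤∣p∣+∣q∣ p q) (+-monoʳ-≤ ∣ p ∣ (n≤1+n ∣ q ∣)))
∣p∪q∣≤∣p∣+∣q∣ (inside  V.∷ p) (outside V.∷ q) = s≤s (∣p∪q∣≤∣p∣+∣q∣ p q)
∣p∪q∣≤∣p∣+∣q∣ (outside V.∷ p) (inside  V.∷ q) =
  ≤-trans (s≤s (∣p∪q∣≤∣p∣+∣q∣ p q)) (≤-reflexive (sym (+-suc ∣ p ∣ ∣ q ∣)))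
∣p∪q∣≤∣p∣+∣q∣ (outside V.∷ p) (outside V.∷ q) = ∣p∪q∣≤∣p∣+∣q∣ p q

module _ {m : ℕ} {Q : Fin m → Set} (Q? : ∀ w → Dec (Q w)) where

  subsetOf : Subset m
  subsetOf = V.tabulate (λ w → does (Q? w))

  ∈-subsetOf⁺ : ∀ {w} → Q w → w ∈ₛ subsetOf
  ∈-subsetOf⁺ {w} q = VP.lookup⇒[]= w _ (trans (VP.lookup∘tabulate _ w) (dec-true (Q? w) q))

  ∈-subsetOf⁻ : ∀ {w} → w ∈ₛ subsetOf → Q w
  ∈-subsetOf⁻ {w} w∈ =
    invert (subst (Reflects (Q w)) (trans (sym (VP.lookup∘tabulate _ w)) (VP.[]=⇒lookup w∈)) (proof (Q? w)))

length-filter-tabulate : ∀ {A : Set} {m} {Q : A → Set} (Q? : ∀ a → Dec (Q a)) (f : Fin m → A) →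
                         length (filter Q? (Data.List.tabulate f)) ≡ ∣ V.tabulate (λ w → does (Q? (f w))) ∣
length-filter-tabulate {m = zero}  Q? f = refl
length-filter-tabulate {m = suc m} Q? f with does (Q? (f F.zero))
... | true  = cong suc (length-filter-tabulate Q? (λ w → f (F.suc w)))
... | false = length-filter-tabulate Q? (λ w → f (F.suc w))

complete⇒≤length : ∀ {t} {xs : List (Fin t)} → (∀ c → c ∈ xs) → t ≤ length xs
complete⇒≤length {xs = xs} complete = FP.injective⇒≤ {f = λ c → index (complete c)} injective
  where
    injective : ∀ {c c′} → index (complete c) ≡ index (complete c′) → c ≡ c′
    injective {c} {c′} eq =
      trans (lookup-index (complete c)) (trans (cong (lookup xs) eq) (sym (lookup-index (complete c′))))

firstIdx<⇒∈-take : ∀ {t} {c : Fin t} {cs} k → c ∈ cs → firstIdx c cs < k → c ∈ take k cs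
firstIdx<⇒∈-take {c = c} {x ∷ cs} (suc k) c∈ (s≤s lt) with c FP.≟ x
... | yes c≡x = here c≡x
firstIdx<⇒∈-take {c = c} {x ∷ cs} (suc k) (here c≡x)  (s≤s lt) | no c≢x = ⊥-elim (c≢x c≡x)
firstIdx<⇒∈-take {c = c} {x ∷ cs} (suc k) (there c∈) (s≤s lt) | no c≢x = there (firstIdx<⇒∈-take k c∈ lt)

firstIdx-here : ∀ {t} (c : Fin t) cs → firstIdx c (c ∷ cs) ≡ 0
firstIdx-here c cs with c FP.≟ c
... | yes _   = refl
... | no c≢c = ⊥-elim (c≢c refl)

firstIdx-there : ∀ {t} {b c : Fin t} cs → b ≢ c → firstIdx b (c ∷ cs) ≡ suc (firstIdx b cs)
firstIdx-there {b = b} {c} cs b≢c with b FP.≟ c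
... | yes b≡c = ⊥-elim (b≢c b≡c)
... | no _    = refl

∈-take-head : ∀ {A : Set} {q} {c : A} {cs} → 1 ≤ q → c ∈ take q (c ∷ cs)
∈-take-head (s≤s _) = here refl

module Neighbourhoods {n : ℕ} (G : Graph n) where
  open Graph G using (Adj; adj?) renaming (sym to Adj-sym)

  N⁻ N⁻[_] : Fin n → Subset n
  N⁻ v   = subsetOf (λ w → pred? G w v)
  N⁻[ v ] = subsetOf (λ w → closed? G w v)

  preds : Fin n → List (Fin n)
  preds v = filter (λ w → pred? G w v) (allFin n)

  ∈-preds : ∀ {v} w → Pred G w v → w ∈ preds v
  ∈-preds {v} w = ∈-filter⁺ (λ w → pred? G w v) (∈-allFin w)

  length-preds : ∀ v → length (preds v) ≡ ∣ N⁻ v ∣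
  length-preds v = length-filter-tabulate (λ w → pred? G w v) (λ w → w)

  ∈N⁻⁻ : ∀ {v w} → w ∈ₛ N⁻ v → Pred G w v
  ∈N⁻⁻ {v} = ∈-subsetOf⁻ (λ w → pred? G w v)

  ∈N⁻[]⁺ : ∀ {v w} → ClosedPred G w v → w ∈ₛ N⁻[ v ]
  ∈N⁻[]⁺ {v} = ∈-subsetOf⁺ (λ w → closed? G w v)

  ∈N⁻[]⁻ : ∀ {v w} → w ∈ₛ N⁻[ v ] → ClosedPred G w v
  ∈N⁻[]⁻ {v} = ∈-subsetOf⁻ (λ w → closed? G w v)

  N⁻⊂N⁻[] : ∀ v → N⁻ v ⊂ N⁻[ v ]
  N⁻⊂N⁻[] v = (λ w∈ → ∈N⁻[]⁺ (inj₂ (∈N⁻⁻ w∈))) ,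
              v , ∈N⁻[]⁺ (inj₁ refl) , (λ v∈ → FP.<-irrefl refl (proj₁ (∈N⁻⁻ v∈)))

  module _ (peo : IsPEO G) where

    N⁻[]-clique : ∀ {v x w} → ClosedPred G x v → ClosedPred G w v → x ≢ w → Adj x w
    N⁻[]-clique (inj₁ refl)     (inj₁ refl)     x≢w = ⊥-elim (x≢w refl)
    N⁻[]-clique (inj₁ refl)     (inj₂ (_ , a)) _   = Adj-sym a
    N⁻[]-clique (inj₂ (_ , a)) (inj₁ refl)     _   = a
    N⁻[]-clique (inj₂ x∈)      (inj₂ w∈)      x≢w = peo _ _ _ x∈ w∈ x≢w

    -- N⁻[v] is a clique, so a vertex x of it of degree at most d inside it sees all of it but x.
    ∣N⁻∣≤d : ∀ {d} → Degenerate G d → ∀ v → ∣ N⁻ v ∣ ≤ d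
    ∣N⁻∣≤d {d} degenerate v with degenerate N⁻[ v ] (v , ∈N⁻[]⁺ (inj₁ refl))
    ... | x , x∈ , deg-x = ≤-pred (≤-trans (SP.p⊂q⇒∣p∣<∣q∣ (N⁻⊂N⁻[] v)) ∣N⁻[]∣≤1+d)
      where
        N⁻[]⊆x∪Nx : N⁻[ v ] ⊆ ⁅ x ⁆ ∪ (nbhd G x ∩ N⁻[ v ])
        N⁻[]⊆x∪Nx {w} w∈ with w FP.≟ x
        ... | yes refl = SP.x∈p∪q⁺ (inj₁ (SP.x∈⁅x⁆ w))
        ... | no w≢x   = SP.x∈p∪q⁺ (inj₂ (SP.x∈p∩q⁺ (∈-subsetOf⁺ (adj? x) x~w , w∈)))
          where
            x~w : Adj x w
            x~w = N⁻[]-clique (∈N⁻[]⁻ x∈) (∈N⁻[]⁻ w∈) (λ x≡w → w≢x (sym x≡w))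
        ∣N⁻[]∣≤1+d : ∣ N⁻[ v ] ∣ ≤ suc d
        ∣N⁻[]∣≤1+d =
          ≤-trans (SP.p⊆q⇒∣p∣≤∣q∣ N⁻[]⊆x∪Nx)
            (≤-trans (∣p∪q∣≤∣p∣+∣q∣ ⁅ x ⁆ _)
              (subst (λ k → k + ∣ nbhd G x ∩ N⁻[ v ] ∣ ≤ suc d) (sym (SP.∣⁅x⁆∣≡1 x)) (s≤s deg-x)))

    length-preds≤d : ∀ {d} → Degenerate G d → ∀ v → length (preds v) ≤ d
    length-preds≤d degenerate v = subst (_≤ _) (sym (length-preds v)) (∣N⁻∣≤d degenerate v)

module Restriction {n t : ℕ} (G : Graph n) where

  ∉N⁻[] : ∀ {x v} → x ≢ v → ¬ Pred G x v → ¬ ClosedPred G x v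
  ∉N⁻[] x≢v _    (inj₁ x≡v) = x≢v x≡v
  ∉N⁻[] _   x∉N⁻ (inj₂ x∈N⁻) = x∉N⁻ x∈N⁻

  later∉N⁻[] : ∀ {u v} → v F.< u → ¬ ClosedPred G u v
  later∉N⁻[] v<u = ∉N⁻[] (λ u≡v → FP.<⇒≢ v<u (sym u≡v)) (λ u∈N⁻ → FP.<-asym v<u (proj₁ u∈N⁻))

  module _ {v x : Fin n} {c : Fin t} (r : List (Step n t)) where

    restrict-accept : ClosedPred G x v → restrict G v ((x , c) ∷ r) ≡ (x , c) ∷ restrict G v r
    restrict-accept x∈ = cong (λ b → if b then (x , c) ∷ restrict G v r else restrict G v r)
                              (dec-true (closed? G x v) x∈)

    restrict-reject : ¬ ClosedPred G x v → restrict G v ((x , c) ∷ r) ≡ restrict G v r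
    restrict-reject x∉ = cong (λ b → if b then (x , c) ∷ restrict G v r else restrict G v r)
                              (dec-false (closed? G x v) x∉)

    futureColors-accept : Pred G x v → futureColors G v ((x , c) ∷ r) ≡ c ∷ futureColors G v r
    futureColors-accept x∈ = cong (λ b → if b then c ∷ futureColors G v r else futureColors G v r)
                                  (dec-true (pred? G x v) x∈)

    futureColors-reject : ¬ Pred G x v → futureColors G v ((x , c) ∷ r) ≡ futureColors G v r
    futureColors-reject x∉ = cong (λ b → if b then c ∷ futureColors G v r else futureColors G v r)
                                  (dec-false (pred? G x v) x∉)

  restrict-∷-cong : ∀ {v} (s : Step n t) {r r′} → restrict G v r′ ≡ restrict G v r →
                    restrict G v (s ∷ r′) ≡ restrict G v (s ∷ r)
  restrict-∷-cong {v} (x , c) eq = cong (λ R → if does (closed? G x v) then (x , c) ∷ R else R) eq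

  restrict-Insert-later : ∀ {β u v cur cu S S′} → Insert G β u cur cu S S′ → v F.< u →
                          restrict G v S′ ≡ restrict G v S
  restrict-Insert-later (ins-end _)          v<u = refl
  restrict-Insert-later (ins-fix _)          v<u = restrict-reject [] (later∉N⁻[] v<u)
  restrict-Insert-later (ins-other {x = x} {c} {r} {r′} _ ins) v<u =
    restrict-∷-cong (x , c) {r} {r′} (restrict-Insert-later ins v<u)
  restrict-Insert-later (ins-free {x = x} {c} {r} {r′} _ _ ins) v<u =
    restrict-∷-cong (x , c) {r} {r′} (restrict-Insert-later ins v<u)
  restrict-Insert-later (ins-clash {x = x} {c} {r} {r′} _ _ _ ins) v<u =
    trans (restrict-reject ((x , c) ∷ r′) (later∉N⁻[] v<u))
          (restrict-∷-cong (x , c) {r} {r′} (restrict-Insert-later ins v<u))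

  Below : ℕ → List (Step n t) → Set
  Below k = All (λ s → toℕ (proj₁ s) < k)

  Insert-Below : ∀ {β u cur cu S S′ k} → Insert G β u cur cu S S′ → Below k S → toℕ u < k → Below k S′
  Insert-Below (ins-end _)           _             _   = []
  Insert-Below (ins-fix _)           _             u<k = u<k ∷ []
  Insert-Below (ins-other _ ins)     (x<k ∷ below) u<k = x<k ∷ Insert-Below ins below u<k
  Insert-Below (ins-free _ _ ins)    (x<k ∷ below) u<k = x<k ∷ Insert-Below ins below u<k
  Insert-Below (ins-clash _ _ _ ins) (x<k ∷ below) u<k = u<k ∷ x<k ∷ Insert-Below ins below u<k

  BCSeq-Below : ∀ {α β i S} → BCSeq G α β i S → Below i S
  BCSeq-Below bcs-nil                = []
  BCSeq-Below (bcs-step u prev ins) =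
    Insert-Below ins (All.map m<n⇒m<1+n (BCSeq-Below prev)) (n<1+n (toℕ u))

module _ {n t : ℕ} (G : Graph n) {u : Fin n} {Ws : List (Fin n)}
         (Ws-complete : ∀ w → Pred G w u → w ∈ Ws) where
  open import Data.List.Membership.DecPropositional (FP._≟_ {t}) using (_∈?_)

  -- Otherwise every colour would be u's own, a neighbour's, or among the first q future
  -- colours, and there are fewer than t of those.
  latest-valid-firstIdx≥ : ∀ {cur cu b} cs q → q + length Ws < t → cu ∈ take q cs →
                           (∀ c → Valid G u cur cu c → c ∈ cs) →
                           (∀ c → Valid G u cur cu c → firstIdx c cs ≤ firstIdx b cs) →
                           q ≤ firstIdx b cs
  latest-valid-firstIdx≥ {cur} {cu} {b} cs q few cu∈ valid⇒∈ latest with q ≤? firstIdx b cs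
  ... | yes q≤ = q≤
  ... | no  q≰ = ⊥-elim (<⇒≱ few (≤-trans (complete⇒≤length blocked) length-blockers))
    where
      blockers : List (Fin t)
      blockers = take q cs ++ map cur Ws

      blocked : ∀ c → c ∈ blockers
      blocked c with c FP.≟ cu
      ... | yes refl = ∈-++⁺ˡ cu∈
      ... | no c≢cu with c ∈? map cur Ws
      ...   | yes c∈ = ∈-++⁺ʳ (take q cs) c∈
      ...   | no  c∉ = ∈-++⁺ˡ (firstIdx<⇒∈-take q (valid⇒∈ c valid) (≤-<-trans (latest c valid) (≰⇒> q≰)))
        where
          valid : Valid G u cur cu c
          valid = c≢cu , λ w w∈N⁻ c≡ → c∉ (subst (_∈ map cur Ws) (sym c≡) (∈-map⁺ cur (Ws-complete w w∈N⁻)))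

      length-blockers : length blockers ≤ q + length Ws
      length-blockers =
        subst (_≤ q + length Ws) (sym (LP.length-++ (take q cs)))
          (+-mono-≤ (subst (_≤ q) (sym (LP.length-take q cs)) (m⊓n≤m q (length cs)))
                    (≤-reflexive (LP.length-map cur Ws)))

module LocalBestChoice {n d : ℕ} (G : Graph n) (1≤d : 1 ≤ d) (β : Fin n → Fin (2 * d + 1))
                       (v : Fin n) {Ws : List (Fin n)} (Ws-complete : ∀ w → Pred G w v → w ∈ Ws)
                       (Ws-small : length Ws ≤ d) where
  open Spacing d v
  open Restriction {n} {2 * d + 1} G

  Colour : Set
  Colour = Fin (2 * d + 1)

  -- m recolourings of N⁻(v) have passed since v received cu, and cs lists the colours of the
  -- remaining ones: the one that takes cu, if any, is at least the d-th since v received cu.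
  Lasting : ℕ → Colour → List Colour → Set
  Lasting m cu cs = d ≤ m + firstIdx cu cs ⊎ cu ∉ cs

  Lasting-∷ : ∀ {m c cu cs} → c ≢ cu → Lasting m cu (c ∷ cs) → Lasting (suc m) cu cs
  Lasting-∷ {m} {cs = cs} c≢cu (inj₁ d≤) =
    inj₁ (subst (d ≤_) (trans (cong (m +_) (firstIdx-there cs (λ cu≡c → c≢cu (sym cu≡c)))) (+-suc m _)) d≤)
  Lasting-∷ c≢cu (inj₂ cu∉) = inj₂ (λ cu∈ → cu∉ (there cu∈))

  Lasting-here : ∀ {m c cs} → Lasting m c (c ∷ cs) → d ≤ m
  Lasting-here {m} {c} {cs} (inj₁ d≤) = subst (d ≤_) (trans (cong (m +_) (firstIdx-here c cs)) (+-identityʳ m)) d≤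
  Lasting-here (inj₂ c∉) = ⊥-elim (c∉ (here refl))

  BestChoice-Lasting : ∀ {cur c cs b} → BestChoice G β v cur c (c ∷ cs) b → Lasting 1 b cs
  BestChoice-Lasting (bc₁ _ β∉)    = inj₂ (λ β∈ → β∉ (there β∈))
  BestChoice-Lasting (bc₂ _ _ b∉)  = inj₂ (λ b∈ → b∉ (there b∈))
  BestChoice-Lasting {c = c} {cs} (bc₃ valid⇒∈ valid latest) =
    inj₁ (subst (d ≤_) (firstIdx-there cs (proj₁ valid))
           (latest-valid-firstIdx≥ G Ws-complete (c ∷ cs) d few (∈-take-head 1≤d) valid⇒∈ latest))
    where
      few : d + length Ws < 2 * d + 1
      few = ≤-trans (s≤s (+-monoʳ-≤ d Ws-small))
                    (≤-reflexive (sym (trans (+-comm (2 * d) 1) (cong (λ k → suc (d + k)) (+-identityʳ d)))))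

  SpacedSeq : ℕ → List (Step n (2 * d + 1)) → Set
  SpacedSeq m R = Spaced m (map proj₁ R)

  Insert⇒Spaced : ∀ {cur cu S S′ m} → Insert G β v cur cu S S′ → Below (toℕ v) S → 1 ≤ m →
                  Lasting m cu (futureColors G v S) → SpacedSeq m (restrict G v S′)
  Insert⇒Spaced (ins-end _) _ _ _ = []
  Insert⇒Spaced (ins-fix _) _ 1≤m _ =
    subst (SpacedSeq _) (sym (restrict-accept [] (inj₁ refl))) (visit 1≤m (inj₂ []) [])
  Insert⇒Spaced (ins-other {r = r} {r′} x∉N⁻ ins) (x<v ∷ below) 1≤m lasting =
    subst (SpacedSeq _) (sym (restrict-reject r′ (∉N⁻[] (FP.<⇒≢ x<v) x∉N⁻)))
      (Insert⇒Spaced ins below 1≤m (subst (Lasting _ _) (futureColors-reject r x∉N⁻) lasting))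
  Insert⇒Spaced (ins-free {r = r} {r′} x∈N⁻ c≢cu ins) (x<v ∷ below) 1≤m lasting =
    subst (SpacedSeq _) (sym (restrict-accept r′ (inj₂ x∈N⁻)))
      (other (FP.<⇒≢ x<v) (Insert⇒Spaced ins below (s≤s z≤n)
        (Lasting-∷ c≢cu (subst (Lasting _ _) (futureColors-accept r x∈N⁻) lasting))))
  Insert⇒Spaced {cur} (ins-clash {x = x} {c} {r} {r′} {b} x∈N⁻ refl choice ins) (x<v ∷ below) 1≤m lasting =
    subst (SpacedSeq _) (sym (trans (restrict-accept ((x , c) ∷ r′) (inj₁ refl))
                                    (cong ((v , b) ∷_) (restrict-accept r′ (inj₂ x∈N⁻)))))
      (visit 1≤m (inj₁ (Lasting-here (subst (Lasting _ _) accept lasting)))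
        (other (FP.<⇒≢ x<v)
          (Insert⇒Spaced ins below (s≤s z≤n)
            (BestChoice-Lasting (subst (λ cs → BestChoice G β v cur c cs b) accept choice)))))
    where
      accept : futureColors G v ((x , c) ∷ r) ≡ c ∷ futureColors G v r
      accept = futureColors-accept r x∈N⁻

  BCSeq-Spaced : ∀ {α i S} → BCSeq G α β i S → toℕ v < i → SpacedSeq d (restrict G v S)
  BCSeq-Spaced (bcs-step u prev ins) (s≤s v≤u) with m≤n⇒m<n∨m≡n v≤u
  ... | inj₁ v<u = subst (SpacedSeq d) (sym (restrict-Insert-later ins v<u)) (BCSeq-Spaced prev v<u)
  ... | inj₂ v≡u with FP.toℕ-injective v≡u
  ...   | refl = Insert⇒Spaced ins (BCSeq-Below prev) 1≤d (inj₁ (m≤m+n d _))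

mainTheorem3 : (d : ℕ) → 3 ≤ d → {n : ℕ} (G : Graph n) → IsPEO G → Degenerate G d →
    (α β : Fin n → Fin (2 * d + 1)) → Proper G α → Proper G β →
    (S : List (Step n (2 * d + 1))) → BestChoiceSeq G α β S →
    (v : Fin n) (ws : List (Fin n)) → All (λ w → Pred G w v) ws → length ws ≤ d ∸ 1 →
    (∀ i → ¬ OccursAt (v ∷ v ∷ []) (restrict G v S) i)
    × (∀ i j → OccursAt (v ∷ ws ++ v ∷ []) (restrict G v S) i →
               OccursAt (v ∷ ws ++ v ∷ []) (restrict G v S) j → i ≡ j)
    × (∀ i → OccursAt (v ∷ ws ++ v ∷ []) (restrict G v S) i →
         ∀ k → OccursAt (v ∷ []) (restrict G v S) k → k ≤ i + suc (length ws))
mainTheorem3 d@(suc _) (s≤s _) G peo degenerate α β _ _ S best v ws ws⊆N⁻ |ws|≤d∸1 =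
  Spaced⇒¬Occurs-vv spaced ,
  Spaced⇒Occurs-unique spaced ws≢v (s≤s |ws|≤d∸1) ,
  Spaced⇒Occurs-last spaced ws≢v (s≤s |ws|≤d∸1)
  where
    open Spacing d v
    open Neighbourhoods G

    spaced : Spaced d (map proj₁ (restrict G v S))
    spaced = LocalBestChoice.BCSeq-Spaced G (s≤s z≤n) β v ∈-preds (length-preds≤d peo degenerate v)
               best (FP.toℕ<n v)

    ws≢v : All (_≢ v) ws
    ws≢v = All.map (λ w∈N⁻ → FP.<⇒≢ (proj₁ w∈N⁻)) ws⊆N⁻
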